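{- Let $a_1,\dots,a_n$ be nonzero integers, $a_0$ a nonzero integer, and $p=\sum_{i=1}^n a_ix_i+a_0$. If $\sum_{i=1}^n a_i=1$ and $a_0<0$, then $\mathcal S(p)\subseteq\{\mathbb N_0\}$, i.e. no numerical semigroup other than $\mathbb N_0$ admits $p$.
   Context: A numerical semigroup is a subset $\Lambda\subseteq\mathbb N_0$ containing $0$, closed under addition, with finite complement in $\mathbb N_0$. $\Lambda$ admits $p$ if $p(s_1,\dots,s_n)\in\Lambda$ for all nonzero $s_1\geq\cdots\geq s_n$ in $\Lambda$; $\mathcal S(p)$ is the set of numerical semigroups admitting $p$. -}

module Defs where

open import Level using (Level; suc; _⊔_)
open import Data.Nat as ℕ using (ℕ; zero)
open import Data.Integer as ℤ using (ℤ; +_)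
open import Data.Fin as F using (Fin)
open import Data.Product using (Σ; ∃; _×_)
open import Relation.Binary.PropositionalEquality using (_≡_)
open import Relation.Nullary using (¬_)

record IsNumericalSemigroup (Λ : ℕ → Set) : Set where
  field
    has-zero   : Λ 0
    closed-add : ∀ a b → Λ a → Λ b → Λ (a ℕ.+ b)
    cofinite   : ∃ λ N → ∀ m → N ℕ.≤ m → Λ m

sumℤ : ∀ {n} → (Fin n → ℤ) → ℤ
sumℤ {zero}    f = + 0
sumℤ {ℕ.suc n} f = f F.zero ℤ.+ sumℤ (λ i → f (F.suc i))

evalLin : ∀ {n} → (Fin n → ℤ) → ℤ → (Fin n → ℕ) → ℤ
evalLin a a₀ s = sumℤ (λ i → a i ℤ.* + s i) ℤ.+ a₀

-- Λ contains the integer z (so in particular z ≥ 0).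
_∈ℤ_ : ℤ → (ℕ → Set) → Set
z ∈ℤ Λ = ∃ λ m → (z ≡ + m) × Λ m

Admits : ∀ {n} → (ℕ → Set) → (Fin n → ℤ) → ℤ → Set
Admits {n} Λ a a₀ =
  (s : Fin n → ℕ) →
  (∀ i → ¬ (s i ≡ 0)) →
  (∀ i → Λ (s i)) →
  (∀ i j → i F.≤ j → s j ℕ.≤ s i) →
  evalLin a a₀ s ∈ℤ Λ

module Submission where

-- Write a₀ = -(d) with d ≥ 1.  Feeding the constant tuple
-- s₁ = ⋯ = sₙ = x into p gives p(x,…,x) = (Σ aᵢ)·x + a₀ = x - d, since the
-- coefficients sum to 1.  Hence if Λ admits p, every nonzero x ∈ Λ with
-- x ≥ d forces x - d ∈ Λ: in other words Λ (m + d) → Λ m for all m.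
-- A numerical semigroup contains every sufficiently large natural, and from
-- there this "downward step" reaches every natural number, so Λ = ℕ₀.

open import Defs
open import Data.Nat using (ℕ)
open import Data.Integer using (ℤ; +_; _<_)
open import Data.Fin using (Fin)
open import Relation.Binary.PropositionalEquality using (_≡_)
open import Relation.Nullary using (¬_)

import Data.Nat as ℕ
import Data.Nat.Properties as ℕP
import Data.Integer as ℤ
import Data.Integer.Properties as ℤP
import Data.Fin as F
open import Data.Product using (_,_; proj₁; proj₂)
open import Function using (const)
open import Relation.Binary.PropositionalEquality
  using (refl; sym; trans; cong; subst; module ≡-Reasoning)

sumℤ-*ʳ : ∀ {n} (a : Fin n → ℤ) (x : ℤ) →
          sumℤ (λ i → a i ℤ.* x) ≡ sumℤ a ℤ.* x
sumℤ-*ʳ {ℕ.zero}  a x = refl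
sumℤ-*ʳ {ℕ.suc n} a x = begin
  a F.zero ℤ.* x ℤ.+ sumℤ (λ i → a (F.suc i) ℤ.* x)
    ≡⟨ cong (ℤ._+_ (a F.zero ℤ.* x)) (sumℤ-*ʳ (λ i → a (F.suc i)) x) ⟩
  a F.zero ℤ.* x ℤ.+ sumℤ (λ i → a (F.suc i)) ℤ.* x
    ≡⟨ ℤP.*-distribʳ-+ x (a F.zero) (sumℤ (λ i → a (F.suc i))) ⟨
  sumℤ a ℤ.* x ∎
  where open ≡-Reasoning

evalLin-const : ∀ {n} (a : Fin n → ℤ) (a₀ : ℤ) (x : ℕ) →
                evalLin a a₀ (const x) ≡ sumℤ a ℤ.* + x ℤ.+ a₀
evalLin-const a a₀ x = cong (ℤ._+ a₀) (sumℤ-*ʳ a (+ x))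

-- Descent: a predicate on ℕ that holds from some point on and satisfies
-- P (m + d) → P m for a fixed step d holds everywhere.  (For d = 0 the
-- step hypothesis is trivial and the conclusion fails, so d is positive.)
descent : (P : ℕ → Set) (d : ℕ) .{{_ : ℕ.NonZero d}} →
          (∀ m → P (m ℕ.+ d) → P m) →
          (N : ℕ) → (∀ m → N ℕ.≤ m → P m) →
          ∀ m → P m
descent P d step N cofinite m = down N m (cofinite _ N≤m+N*d)
  where
  down : ∀ k m → P (m ℕ.+ k ℕ.* d) → P m
  down ℕ.zero    m h = subst P (ℕP.+-identityʳ m) h
  down (ℕ.suc k) m h =
    step m (down k (m ℕ.+ d) (subst P (sym (ℕP.+-assoc m d (k ℕ.* d))) h))

  N≤m+N*d : N ℕ.≤ m ℕ.+ N ℕ.* d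
  N≤m+N*d = ℕP.≤-trans (ℕP.m≤m*n N d) (ℕP.m≤n+m (N ℕ.* d) m)

+[m+d]-d≡m : ∀ m d → + (m ℕ.+ d) ℤ.- + d ≡ + m
+[m+d]-d≡m m ℕ.zero    = trans (ℤP.+-identityʳ _) (cong +_ (ℕP.+-identityʳ m))
+[m+d]-d≡m m (ℕ.suc d) = begin
  (m ℕ.+ ℕ.suc d) ℤ.⊖ ℕ.suc d  ≡⟨ ℤP.⊖-≥ (ℕP.m≤n+m (ℕ.suc d) m) ⟩
  + (m ℕ.+ ℕ.suc d ℕ.∸ ℕ.suc d) ≡⟨ cong +_ (ℕP.m+n∸n≡m m (ℕ.suc d)) ⟩
  + m                            ∎
  where open ≡-Reasoning

∈ℤ⇒∈ : ∀ {Λ : ℕ → Set} {z : ℤ} {m : ℕ} → z ∈ℤ Λ → z ≡ + m → Λ m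
∈ℤ⇒∈ {Λ} (m′ , z≡m′ , Λm′) z≡m = subst Λ (ℤP.+-injective (trans (sym z≡m′) z≡m)) Λm′

-- The downward step: if the coefficients of p sum to 1 and a₀ = -d with
-- d ≥ 1, any Λ admitting p satisfies Λ (m + d) → Λ m, witnessed by the
-- constant tuple (m + d, …, m + d), which is nonzero and non-increasing.
admits-step : ∀ {n} (a : Fin n → ℤ) (d : ℕ) .{{_ : ℕ.NonZero d}} →
              sumℤ a ≡ + 1 → (Λ : ℕ → Set) → Admits Λ a (ℤ.- + d) →
              ∀ m → Λ (m ℕ.+ d) → Λ m
admits-step a d Σa≡1 Λ admits m Λ[m+d] =
  ∈ℤ⇒∈ (admits (const (m ℕ.+ d)) (λ _ → m+d≢0) (λ _ → Λ[m+d]) (λ _ _ _ → ℕP.≤-refl)) p≡m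
  where
  open ≡-Reasoning

  m+d≢0 : ¬ (m ℕ.+ d ≡ 0)
  m+d≢0 m+d≡0 = ℕ.≢-nonZero⁻¹ d (ℕP.m+n≡0⇒n≡0 m m+d≡0)

  p≡m : evalLin a (ℤ.- + d) (const (m ℕ.+ d)) ≡ + m
  p≡m = begin
    evalLin a (ℤ.- + d) (const (m ℕ.+ d))   ≡⟨ evalLin-const a (ℤ.- + d) (m ℕ.+ d) ⟩
    sumℤ a ℤ.* + (m ℕ.+ d) ℤ.+ ℤ.- + d      ≡⟨ cong (λ t → t ℤ.* + (m ℕ.+ d) ℤ.- + d) Σa≡1 ⟩
    + 1 ℤ.* + (m ℕ.+ d) ℤ.- + d             ≡⟨ cong (λ t → t ℤ.- + d) (ℤP.*-identityˡ (+ (m ℕ.+ d))) ⟩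
    + (m ℕ.+ d) ℤ.- + d                     ≡⟨ +[m+d]-d≡m m d ⟩
    + m                                     ∎

-- A negative a₀ has the form -(c + 1), and
-- descent with step c + 1 applies from the cofiniteness bound of Λ.
mainTheorem8 : (n : ℕ) (a : Fin n → ℤ) (a₀ : ℤ) →
    (∀ i → ¬ (a i ≡ + 0)) → ¬ (a₀ ≡ + 0) →
    sumℤ a ≡ + 1 → a₀ < + 0 →
    (Λ : ℕ → Set) → IsNumericalSemigroup Λ → Admits Λ a a₀ →
    ∀ m → Λ m
mainTheorem8 n a (+ _)       _ _ _    (ℤ.+<+ ()) Λ _ _
mainTheorem8 n a ℤ.-[1+ c ]  _ _ Σa≡1 _          Λ semigroup admits =
  descent Λ (ℕ.suc c) (admits-step a (ℕ.suc c) Σa≡1 Λ admits)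
          (proj₁ cofinite) (proj₂ cofinite)
  where open IsNumericalSemigroup semigroup using (cofinite)
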